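{- Let $n\ge1$. All max shuffles on $S_n$ have the same termination number: if $M,M'$ are max shuffles on $S_n$, then $\operatorname{tn}M=\operatorname{tn}M'$.
   Context: $[n]=\{1,\dots,n\}$, $[a,b]=\{a,\dots,b\}$; $S_n$ is the group of bijections $[n]\to[n]$. A homing shuffle is a map $F:S_n\to S_n$ such that for every $w\in S_n$, setting $k:=w(1)$: (a) $F(w)(k)=k$, and (b) $F(w)(i)=w(i)$ for all $i>k$. A max shuffle is a homing shuffle $M$ such that for every $w\in S_n$ with $w(1)\neq1$, $M(w)(1)=\max(w([2,k]))$ where $k=w(1)$. The termination number $\operatorname{tn}F$ is the smallest $m\in\mathbb{N}$ such that $F^m(w)(1)=1$ for all $w\in S_n$ ($F^m$ the $m$-th iterate). -}

module Defs where

open import Data.Nat using (ℕ; zero; suc; _≤_; _<_; _⊔_)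
open import Data.Nat.Properties using (_≤?_)
open import Data.Fin using (Fin; toℕ) renaming (zero to fzero)
open import Data.Fin.Permutation using (Permutation′; _⟨$⟩ʳ_)
open import Data.List using (List; foldr; map; filter; tabulate)
open import Data.Product using (_×_; Σ)
open import Relation.Binary.PropositionalEquality using (_≡_)
open import Relation.Nullary using (¬_)
open import Relation.Nullary.Decidable using (_×-dec_)

-- Convention: the elements 1,…,n of [n] are represented by Fin n via i ↦ i-1
-- (so the position/value 1 is fzero, and toℕ i = (i as an element of [n]) - 1).
-- We work with S_(suc n), i.e. the paper's n ≥ 1 is our suc n.

allFin′ : (m : ℕ) → List (Fin m)
allFin′ m = tabulate {n = m} (λ i → i)

IsHomingShuffle : {n : ℕ} → (Permutation′ (suc n) → Permutation′ (suc n)) → Set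
IsHomingShuffle {n} F =
  (w : Permutation′ (suc n)) →
    (F w ⟨$⟩ʳ (w ⟨$⟩ʳ fzero) ≡ w ⟨$⟩ʳ fzero)
    × ((i : Fin (suc n)) → toℕ (w ⟨$⟩ʳ fzero) < toℕ i → F w ⟨$⟩ʳ i ≡ w ⟨$⟩ʳ i)

-- max(w([2,k])) (shifted by -1, as a natural number): the maximum of toℕ (w i)
-- over positions i with 2 ≤ i ≤ k, i.e. 1 ≤ toℕ i ≤ toℕ k.  (Nonempty when k ≠ 1.)
segMax : {n : ℕ} → Permutation′ (suc n) → Fin (suc n) → ℕ
segMax {n} w k =
  foldr _⊔_ 0
    (map (λ i → toℕ (w ⟨$⟩ʳ i))
      (filter (λ i → (1 ≤? toℕ i) ×-dec (toℕ i ≤? toℕ k)) (allFin′ (suc n))))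

IsMaxShuffle : {n : ℕ} → (Permutation′ (suc n) → Permutation′ (suc n)) → Set
IsMaxShuffle {n} M =
  IsHomingShuffle M ×
  ((w : Permutation′ (suc n)) → ¬ (w ⟨$⟩ʳ fzero ≡ fzero) →
     toℕ (M w ⟨$⟩ʳ fzero) ≡ segMax w (w ⟨$⟩ʳ fzero))

iter : {A : Set} → (A → A) → ℕ → A → A
iter F zero x = x
iter F (suc m) x = F (iter F m x)

TerminatesIn : {n : ℕ} → (Permutation′ (suc n) → Permutation′ (suc n)) → ℕ → Set
TerminatesIn {n} F m = (w : Permutation′ (suc n)) → iter F m w ⟨$⟩ʳ fzero ≡ fzero

IsTerminationNumber : {n : ℕ} → (Permutation′ (suc n) → Permutation′ (suc n)) → ℕ → Set
IsTerminationNumber F m = TerminatesIn F m × ((m′ : ℕ) → TerminatesIn F m′ → m ≤ m′)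

-- In the paper's indexing (permutations of [n], top card k = w(1)): a max shuffle moves card
-- k to position k, so the new top differs from k, and the top value rises or falls at every
-- step. It can rise at most n − 2 times in a row. The first time it falls, every card at
-- positions 2, …, k′ (k′ the new top) is smaller than k′: cards beyond the old top did not
-- move, and the maximum of the old segment went to the top. This property is preserved and
-- forces the top to keep falling, reaching 1 after at most n − 2 further steps; in total at
-- most 2n − 3 steps. The cycle (2, 3, …, n, 1) needs exactly 2n − 3: its top rises through
-- 2, …, n one by one and then falls through n − 1, …, 1, every step being determined by the
-- max property alone.
module Submission where

open import Defs
open import Data.Nat using (ℕ; zero; suc; _+_; _∸_; _≤_; _<_; _⊔_; z≤n; s≤s; >-nonZero)
open import Data.Nat.Properties
open import Data.Fin using (Fin; toℕ; fromℕ<; fromℕ; inject₁; punchIn)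
  renaming (zero to fzero; suc to fsuc)
open import Data.Fin.Properties using (toℕ-injective; toℕ-fromℕ<; toℕ<n; toℕ-inject₁)
open import Data.Fin.Permutation
  using (Permutation′; _⟨$⟩ʳ_; _⟨$⟩ˡ_; inverseˡ; inverseʳ; insert; insert-punchIn; id)
open import Data.List using (List; _∷_; foldr)
open import Data.List.Properties using (foldr-preservesᵇ)
open import Data.List.Membership.Propositional using (_∈_)
open import Data.List.Membership.Propositional.Properties using (∈-map⁺; ∈-filter⁺; ∈-tabulate⁺)
open import Data.List.Relation.Unary.Any using (here; there)
import Data.List.Relation.Unary.All as All
open import Data.List.Relation.Unary.All.Properties using (all-filter; map⁺)
open import Data.Product using (Σ; _×_; _,_; proj₁; proj₂)
open import Data.Sum using (_⊎_; inj₁; inj₂)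
open import Data.Empty using (⊥)
open import Function using (_∘_)
open import Relation.Binary.Definitions using (tri<; tri≈; tri>)
open import Relation.Binary.PropositionalEquality
open import Relation.Nullary using (yes; no; contradiction)
open import Relation.Nullary.Decidable using (Dec; _×-dec_)

⊔-foldr-upperBound : ∀ {x : ℕ} {xs : List ℕ} → x ∈ xs → x ≤ foldr _⊔_ 0 xs
⊔-foldr-upperBound {xs = y ∷ _} (here refl)  = m≤m⊔n y _
⊔-foldr-upperBound {xs = y ∷ _} (there x∈xs) = ≤-trans (⊔-foldr-upperBound x∈xs) (m≤n⊔m y _)

1≤toℕ⇒≢fzero : ∀ {m} {i : Fin (suc m)} → 1 ≤ toℕ i → i ≢ fzero
1≤toℕ⇒≢fzero 1≤i refl = contradiction 1≤i λ ()

⟨$⟩ʳ-injective : ∀ {m} (π : Permutation′ m) {i j} → π ⟨$⟩ʳ i ≡ π ⟨$⟩ʳ j → i ≡ j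
⟨$⟩ʳ-injective π {i} {j} πi≡πj = begin
  i                   ≡⟨ inverseˡ π ⟨
  π ⟨$⟩ˡ (π ⟨$⟩ʳ i)   ≡⟨ cong (π ⟨$⟩ˡ_) πi≡πj ⟩
  π ⟨$⟩ˡ (π ⟨$⟩ʳ j)   ≡⟨ inverseˡ π ⟩
  j                   ∎
  where open ≡-Reasoning

iter-suc : ∀ {A : Set} (F : A → A) m x → iter F (suc m) x ≡ iter F m (F x)
iter-suc F zero    x = refl
iter-suc F (suc m) x = cong F (iter-suc F m x)

iter-+ : ∀ {A : Set} (F : A → A) m m′ x → iter F (m + m′) x ≡ iter F m (iter F m′ x)
iter-+ F zero    m′ x = refl
iter-+ F (suc m) m′ x = cong F (iter-+ F m m′ x)

module _ {n : ℕ} where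

  InSegment : Fin (suc n) → Fin (suc n) → Set
  InSegment k j = 1 ≤ toℕ j × toℕ j ≤ toℕ k

  inSegment? : ∀ k j → Dec (InSegment k j)
  inSegment? k j = (1 ≤? toℕ j) ×-dec (toℕ j ≤? toℕ k)

  segMax-upperBound : ∀ (w : Permutation′ (suc n)) k j →
    InSegment k j → toℕ (w ⟨$⟩ʳ j) ≤ segMax w k
  segMax-upperBound w k j j∈k = ⊔-foldr-upperBound
    (∈-map⁺ (λ i → toℕ (w ⟨$⟩ʳ i))
      (∈-filter⁺ (inSegment? k) (∈-tabulate⁺ {f = λ i → i} j) j∈k))

  segMax-lub : ∀ (w : Permutation′ (suc n)) k b →
    (∀ j → InSegment k j → toℕ (w ⟨$⟩ʳ j) ≤ b) → segMax w k ≤ b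
  segMax-lub w k b bounded = foldr-preservesᵇ {P = _≤ b} ⊔-lub z≤n
    (map⁺ {f = λ i → toℕ (w ⟨$⟩ʳ i)}
      (All.map (λ {j} → bounded j) (all-filter (inSegment? k) (allFin′ (suc n)))))

  segMax-≡ : ∀ (w : Permutation′ (suc n)) k v →
    (∀ j → InSegment k j → toℕ (w ⟨$⟩ʳ j) ≤ v) →
    ∀ p → InSegment k p → toℕ (w ⟨$⟩ʳ p) ≡ v → segMax w k ≡ v
  segMax-≡ w k v bounded p p∈k wp≡v = ≤-antisym (segMax-lub w k v bounded)
    (subst (_≤ segMax w k) wp≡v (segMax-upperBound w k p p∈k))

punchIn-fromℕ : ∀ {n} (i : Fin n) → punchIn (fromℕ n) i ≡ inject₁ i
punchIn-fromℕ fzero    = refl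
punchIn-fromℕ (fsuc i) = cong fsuc (punchIn-fromℕ i)

-- The cycle (2, 3, …, n + 1, 1) in one-line notation.
cycle : ∀ n → Permutation′ (suc n)
cycle n = insert (fromℕ n) fzero id

cycle-inject₁ : ∀ {n} (i : Fin n) → cycle n ⟨$⟩ʳ inject₁ i ≡ fsuc i
cycle-inject₁ {n} i = begin
  cycle n ⟨$⟩ʳ inject₁ i             ≡⟨ cong (cycle n ⟨$⟩ʳ_) (punchIn-fromℕ i) ⟨
  cycle n ⟨$⟩ʳ punchIn (fromℕ n) i   ≡⟨ insert-punchIn (fromℕ n) fzero id i ⟩
  fsuc i                            ∎
  where open ≡-Reasoning

module MaxShuffle {n : ℕ} (M : Permutation′ (suc n) → Permutation′ (suc n)) (isMax : IsMaxShuffle M)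
  where

  Perm : Set
  Perm = Permutation′ (suc n)

  top : Perm → ℕ
  top w = toℕ (w ⟨$⟩ʳ fzero)

  Home : Perm → Set
  Home w = w ⟨$⟩ʳ fzero ≡ fzero

  home-or-positive : ∀ w → Home w ⊎ 1 ≤ top w
  home-or-positive w with w ⟨$⟩ʳ fzero
  ... | fzero  = inj₁ refl
  ... | fsuc _ = inj₂ (s≤s z≤n)

  top≤n : ∀ w → top w ≤ n
  top≤n w = ≤-pred (toℕ<n (w ⟨$⟩ʳ fzero))

  M-sends-top-home : ∀ w → M w ⟨$⟩ʳ (w ⟨$⟩ʳ fzero) ≡ w ⟨$⟩ʳ fzero
  M-sends-top-home w = proj₁ (proj₁ isMax w)

  M-fixes-beyond-top : ∀ w i → top w < toℕ i → M w ⟨$⟩ʳ i ≡ w ⟨$⟩ʳ i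
  M-fixes-beyond-top w = proj₂ (proj₁ isMax w)

  top-M : ∀ w → 1 ≤ top w → top (M w) ≡ segMax w (w ⟨$⟩ʳ fzero)
  top-M w pos = proj₂ isMax w (1≤toℕ⇒≢fzero pos)

  M-preimage-top : ∀ w {j} → M w ⟨$⟩ʳ j ≡ w ⟨$⟩ʳ fzero → j ≡ w ⟨$⟩ʳ fzero
  M-preimage-top w Mwj≡ = ⟨$⟩ʳ-injective (M w) (trans Mwj≡ (sym (M-sends-top-home w)))

  M-preimage-beyond-top : ∀ w {i j} → top w < toℕ j → M w ⟨$⟩ʳ i ≡ w ⟨$⟩ʳ j → i ≡ j
  M-preimage-beyond-top w beyond Mwi≡ =
    ⟨$⟩ʳ-injective (M w) (trans Mwi≡ (sym (M-fixes-beyond-top w _ beyond)))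

  top-M≢top : ∀ w → 1 ≤ top w → top (M w) ≢ top w
  top-M≢top w pos same = 1≤toℕ⇒≢fzero pos (sym (M-preimage-top w (toℕ-injective same)))

  home-M : ∀ w → Home w → Home (M w)
  home-M w home = begin
    M w ⟨$⟩ʳ fzero            ≡⟨ cong (M w ⟨$⟩ʳ_) home ⟨
    M w ⟨$⟩ʳ (w ⟨$⟩ʳ fzero)   ≡⟨ M-sends-top-home w ⟩
    w ⟨$⟩ʳ fzero              ≡⟨ home ⟩
    fzero                     ∎
    where open ≡-Reasoning

  home-iter : ∀ w → Home w → ∀ m → Home (iter M m w)
  home-iter w home zero    = home
  home-iter w home (suc m) = home-M (iter M m w) (home-iter w home m)

  home-iter-mono : ∀ w {m m′} → m ≤ m′ → Home (iter M m w) → Home (iter M m′ w)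
  home-iter-mono w {m} {m′} m≤m′ home = subst Home eq (home-iter (iter M m w) home (m′ ∸ m))
    where
    eq : iter M (m′ ∸ m) (iter M m w) ≡ iter M m′ w
    eq = trans (sym (iter-+ M (m′ ∸ m) m w)) (cong (λ t → iter M t w) (m∸n+n≡m m≤m′))

  home-iter-suc : ∀ w m → Home (iter M m (M w)) → Home (iter M (suc m) w)
  home-iter-suc w m = subst Home (sym (iter-suc M m w))

  TopBoundsSegment : Perm → Set
  TopBoundsSegment w = ∀ j → InSegment (w ⟨$⟩ʳ fzero) j → toℕ (w ⟨$⟩ʳ j) < top w

  -- The card M w puts at position i came from some position j of w: not beyond the top (those
  -- cards stay put), not the first (that card went to position top w ≠ i), so j lies in the
  -- segment; and the segment's maximum went to the first position, not to i.
  M-below-segMax : ∀ w → 1 ≤ top w → ∀ i → 1 ≤ toℕ i → toℕ i < top w →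
    toℕ (M w ⟨$⟩ʳ i) < segMax w (w ⟨$⟩ʳ fzero)
  M-below-segMax w pos i pos-i i<top = from-preimage (w ⟨$⟩ˡ (M w ⟨$⟩ʳ i)) (inverseʳ w)
    where
    from-preimage : ∀ j → w ⟨$⟩ʳ j ≡ M w ⟨$⟩ʳ i →
      toℕ (M w ⟨$⟩ʳ i) < segMax w (w ⟨$⟩ʳ fzero)
    from-preimage j wj≡Mwi with top w <? toℕ j
    ... | yes beyond = contradiction
      (subst (λ k → top w < toℕ k) (sym (M-preimage-beyond-top w beyond (sym wj≡Mwi))) beyond)
      (<⇒≱ i<top ∘ <⇒≤)
    from-preimage fzero wj≡Mwi | no _ =
      contradiction (cong toℕ (M-preimage-top w (sym wj≡Mwi))) (<⇒≢ i<top)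
    from-preimage (fsuc j) wj≡Mwi | no within = ≤∧≢⇒<
      (subst (_≤ segMax w (w ⟨$⟩ʳ fzero)) (cong toℕ wj≡Mwi)
        (segMax-upperBound w _ (fsuc j) (s≤s z≤n , ≮⇒≥ within)))
      (λ eq → 1≤toℕ⇒≢fzero pos-i
        (⟨$⟩ʳ-injective (M w) (toℕ-injective (trans eq (sym (top-M w pos))))))

  topBounds-M : ∀ w → 1 ≤ top w → top (M w) < top w → TopBoundsSegment (M w)
  topBounds-M w pos fell j (pos-j , j≤top) = subst (toℕ (M w ⟨$⟩ʳ j) <_) (sym (top-M w pos))
    (M-below-segMax w pos j pos-j (≤-<-trans j≤top fell))

  top-M<top : ∀ w → 1 ≤ top w → TopBoundsSegment w → top (M w) < top w
  top-M<top w pos bounded = m≤pred[n]⇒suc[m]≤n {{>-nonZero pos}}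
    (subst (_≤ _) (sym (top-M w pos))
      (segMax-lub w _ _ λ j j∈ → suc[m]≤n⇒m≤pred[n] (bounded j j∈)))

  home-after-top : ∀ t w → top w ≤ t → TopBoundsSegment w → Home (iter M t w)
  home-after-top t w top≤t bounded with home-or-positive w
  ... | inj₁ home = home-iter w home t
  home-after-top zero    w top≤0 bounded | inj₂ pos = contradiction (≤-trans pos top≤0) λ ()
  home-after-top (suc t) w top≤t bounded | inj₂ pos = home-iter-suc w t
    (home-after-top t (M w) (≤-pred (<-≤-trans fell top≤t)) (topBounds-M w pos fell))
    where
    fell : top (M w) < top w
    fell = top-M<top w pos bounded

  home-after-gap : ∀ d w → n ∸ top w ≤ d → Home (iter M (d + n) w)
  home-after-gap d w gap≤d with home-or-positive w
  ... | inj₁ home = home-iter w home (d + n)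
  ... | inj₂ pos with <-cmp (top (M w)) (top w)
  ...   | tri< fell _ _ = home-iter-mono w (≤-trans fell (≤-trans (top≤n w) (m≤n+m n d)))
          (home-iter-suc w (top (M w)) (home-after-top (top (M w)) (M w) ≤-refl (topBounds-M w pos fell)))
  ...   | tri≈ _ same _ = contradiction same (top-M≢top w pos)
  home-after-gap zero    w gap≤0 | inj₂ pos | tri> _ _ rose =
    contradiction (≤-trans (∸-monoʳ-< rose (top≤n (M w))) gap≤0) λ ()
  home-after-gap (suc d) w gap≤d | inj₂ pos | tri> _ _ rose = home-iter-suc w (d + n)
    (home-after-gap d (M w) (≤-pred (≤-trans (∸-monoʳ-< rose (top≤n (M w))) gap≤d)))

  terminatesIn-upper : TerminatesIn M (n + n ∸ 1)
  terminatesIn-upper w with home-or-positive w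
  ... | inj₁ home = home-iter w home (n + n ∸ 1)
  ... | inj₂ pos = home-iter-mono w gap+n≤ (home-after-gap (n ∸ top w) w ≤-refl)
    where
    open ≤-Reasoning
    gap+n≤ : n ∸ top w + n ≤ n + n ∸ 1
    gap+n≤ = begin
      n ∸ top w + n  ≤⟨ +-monoˡ-≤ n (∸-monoʳ-≤ n pos) ⟩
      n ∸ 1 + n      ≡⟨ +-∸-comm n (≤-trans pos (top≤n w)) ⟨
      n + n ∸ 1      ∎

  Rising : ℕ → Perm → Set
  Rising x w = top w ≡ x × (∀ (i : Fin n) → x ≤ toℕ i → w ⟨$⟩ʳ inject₁ i ≡ fsuc i)

  rising-step : ∀ x w → 1 ≤ x → x < n → Rising x w → Rising (suc x) (M w)
  rising-step x w pos x<n (top≡x , shifts) = top-M≡ , shifts-M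
    where
    p : Fin n
    p = fromℕ< x<n
    toℕ-p : toℕ (inject₁ p) ≡ x
    toℕ-p = trans (toℕ-inject₁ p) (toℕ-fromℕ< x<n)
    bounded : ∀ j → InSegment (w ⟨$⟩ʳ fzero) j → toℕ (w ⟨$⟩ʳ j) ≤ suc x
    bounded j (_ , j≤top) with w ⟨$⟩ʳ j in wj≡
    ... | fzero  = z≤n
    ... | fsuc i = s≤s (≮⇒≥ λ x<i →
      <⇒≱ (subst (x <_) (toℕ-i≡j x<i) x<i) (subst (toℕ j ≤_) top≡x j≤top))
      where
      toℕ-i≡j : x < toℕ i → toℕ i ≡ toℕ j
      toℕ-i≡j x<i = trans (sym (toℕ-inject₁ i))
        (cong toℕ (⟨$⟩ʳ-injective w (trans (shifts i (<⇒≤ x<i)) (sym wj≡))))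
    top-M≡ : top (M w) ≡ suc x
    top-M≡ = trans (top-M w (subst (1 ≤_) (sym top≡x) pos))
      (segMax-≡ w _ (suc x) bounded (inject₁ p)
        (subst (1 ≤_) (sym toℕ-p) pos , ≤-reflexive (trans toℕ-p (sym top≡x)))
        (trans (cong toℕ (shifts p (≤-reflexive (sym (toℕ-fromℕ< x<n)))))
               (cong suc (toℕ-fromℕ< x<n))))
    shifts-M : ∀ (i : Fin n) → suc x ≤ toℕ i → M w ⟨$⟩ʳ inject₁ i ≡ fsuc i
    shifts-M i x<i = trans
      (M-fixes-beyond-top w (inject₁ i) (subst₂ _<_ (sym top≡x) (sym (toℕ-inject₁ i)) x<i))
      (shifts i (<⇒≤ x<i))

  StableAbove : ℕ → Perm → Set
  StableAbove x w = (∀ j → x < toℕ j → x < toℕ (w ⟨$⟩ʳ j))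
                  × (∀ j → x < toℕ (w ⟨$⟩ʳ j) → x < toℕ j)

  Falling : ℕ → Perm → Set
  Falling x w = top w ≡ x × StableAbove x w

  rising⇒falling : ∀ w → Rising n w → Falling n w
  rising⇒falling w (top≡n , _) = top≡n
    , (λ j n<j → contradiction (≤-pred (toℕ<n j)) (<⇒≱ n<j))
    , (λ j n<wj → contradiction (≤-pred (toℕ<n (w ⟨$⟩ʳ j))) (<⇒≱ n<wj))

  falling-top : ∀ x w → Falling (suc x) w → top (M w) ≡ x
  falling-top x w (top≡ , stays-above , comes-from-above) =
    trans (top-M w pos) (segMax-≡ w _ x bounded q q∈ toℕ-wq)
    where
    pos : 1 ≤ top w
    pos = subst (1 ≤_) (sym top≡) (s≤s z≤n)
    bounded : ∀ j → InSegment (w ⟨$⟩ʳ fzero) j → toℕ (w ⟨$⟩ʳ j) ≤ x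
    bounded j (pos-j , j≤top) = ≮⇒≥ λ x<wj → from-cases (m≤n⇒m<n∨m≡n x<wj)
      where
      from-cases : suc x < toℕ (w ⟨$⟩ʳ j) ⊎ suc x ≡ toℕ (w ⟨$⟩ʳ j) → ⊥
      from-cases (inj₁ above) = <⇒≱ (comes-from-above j above) (subst (toℕ j ≤_) top≡ j≤top)
      from-cases (inj₂ same)  =
        1≤toℕ⇒≢fzero pos-j (⟨$⟩ʳ-injective w (toℕ-injective (trans (sym same) (sym top≡))))
    x<1+n : x < suc n
    x<1+n = ≤-trans (≤-reflexive (sym top≡)) (≤-trans (top≤n w) (n≤1+n n))
    q : Fin (suc n)
    q = w ⟨$⟩ˡ fromℕ< x<1+n
    toℕ-wq : toℕ (w ⟨$⟩ʳ q) ≡ x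
    toℕ-wq = trans (cong toℕ (inverseʳ w)) (toℕ-fromℕ< x<1+n)
    q≢fzero : q ≢ fzero
    q≢fzero q≡0 = <-irrefl (trans (sym toℕ-wq) (cong (λ k → toℕ (w ⟨$⟩ʳ k)) q≡0))
                           (≤-reflexive (sym top≡))
    q∈ : InSegment (w ⟨$⟩ʳ fzero) q
    q∈ = ≮⇒≥ (λ q<1 → q≢fzero (toℕ-injective (n<1⇒n≡0 q<1)))
       , ≮⇒≥ λ top<q → <⇒≱ (stays-above q (subst (_< toℕ q) top≡ top<q))
                          (≤-trans (≤-reflexive toℕ-wq) (n≤1+n x))

  falling-stable : ∀ x w → Falling (suc x) w → StableAbove x (M w)
  falling-stable x w (top≡ , stays-above , comes-from-above) = stays-above-M , comes-from-above-M
    where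
    at-top : ∀ {j} → toℕ j ≡ suc x → j ≡ w ⟨$⟩ʳ fzero
    at-top eq = toℕ-injective (trans eq (sym top≡))
    stays-above-M : ∀ j → x < toℕ j → x < toℕ (M w ⟨$⟩ʳ j)
    stays-above-M j x<j with m≤n⇒m<n∨m≡n x<j
    ... | inj₁ above = subst (λ k → x < toℕ k)
      (sym (M-fixes-beyond-top w j (subst (_< toℕ j) (sym top≡) above))) (<⇒≤ (stays-above j above))
    ... | inj₂ same = subst (λ k → x < toℕ k)
      (sym (trans (cong (M w ⟨$⟩ʳ_) (at-top (sym same))) (M-sends-top-home w)))
      (≤-reflexive (sym top≡))
    comes-from-above-M : ∀ j → x < toℕ (M w ⟨$⟩ʳ j) → x < toℕ j
    comes-from-above-M j x<Mwj with m≤n⇒m<n∨m≡n x<Mwj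
    ... | inj₁ above = <⇒≤ (subst (λ k → suc x < toℕ k) (sym j≡p) p-above)
      where
      p : Fin (suc n)
      p = w ⟨$⟩ˡ (M w ⟨$⟩ʳ j)
      p-above : suc x < toℕ p
      p-above = comes-from-above p (subst (λ k → suc x < toℕ k) (sym (inverseʳ w)) above)
      j≡p : j ≡ p
      j≡p = M-preimage-beyond-top w (subst (_< toℕ p) (sym top≡) p-above) (sym (inverseʳ w))
    ... | inj₂ same = ≤-reflexive (sym (trans (cong toℕ (M-preimage-top w (at-top (sym same)))) top≡))

  falling-step : ∀ x w → Falling (suc x) w → Falling x (M w)
  falling-step x w fall = falling-top x w fall , falling-stable x w fall

  falling : ∀ d x w → Falling (d + x) w → Falling x (iter M d w)
  falling zero    x w fall = fall
  falling (suc d) x w fall = falling-step x (iter M d w)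
    (falling d (suc x) w (subst (λ y → Falling y w) (sym (+-suc d x)) fall))

module LowerBound {k : ℕ} (M : Permutation′ (suc (suc k)) → Permutation′ (suc (suc k)))
  (isMax : IsMaxShuffle M) where

  open MaxShuffle M isMax

  w₀ : Perm
  w₀ = cycle (suc k)

  rising : ∀ s → s < suc k → Rising (suc s) (iter M s w₀)
  rising zero    _     = cong toℕ (cycle-inject₁ {suc k} fzero) , λ i _ → cycle-inject₁ i
  rising (suc s) s<1+k = rising-step (suc s) (iter M s w₀) (s≤s z≤n) s<1+k (rising s (<⇒≤ s<1+k))

  peak : Falling (suc k) (iter M k w₀)
  peak = rising⇒falling (iter M k w₀) (rising k ≤-refl)

  top-positive-before : ∀ m → m < k + suc k → 1 ≤ top (iter M m w₀)
  top-positive-before m m<tn with m ≤? k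
  ... | yes m≤k = subst (1 ≤_) (sym (proj₁ (rising m (s≤s m≤k)))) (s≤s z≤n)
  ... | no m≰k  = subst (λ w → 1 ≤ top w) descent
                    (subst (1 ≤_) (sym (proj₁ fall)) (m<n⇒0<n∸m s<1+k))
    where
    s : ℕ
    s = m ∸ k
    s<1+k : s < suc k
    s<1+k = subst (s <_) (m+n∸m≡n k (suc k)) (∸-monoˡ-< m<tn (≰⇒≥ m≰k))
    fall : Falling (suc k ∸ s) (iter M s (iter M k w₀))
    fall = falling s (suc k ∸ s) (iter M k w₀)
      (subst (λ y → Falling y (iter M k w₀)) (sym (m+[n∸m]≡n (<⇒≤ s<1+k))) peak)
    descent : iter M s (iter M k w₀) ≡ iter M m w₀
    descent = trans (sym (iter-+ M s k w₀)) (cong (λ t → iter M t w₀) (m∸n+n≡m (≰⇒≥ m≰k)))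

  terminatesIn-lower : ∀ m → TerminatesIn M m → k + suc k ≤ m
  terminatesIn-lower m terminates = ≮⇒≥ λ m<tn →
    1≤toℕ⇒≢fzero (top-positive-before m m<tn) (terminates w₀)

-- n + n ∸ 1 is the paper's 2n − 3, as S_(suc n) here is the paper's S_n.
maxShuffle-tn : ∀ n (M : Permutation′ (suc n) → Permutation′ (suc n)) → IsMaxShuffle M →
  IsTerminationNumber M (n + n ∸ 1)
maxShuffle-tn zero    M isMax = MaxShuffle.terminatesIn-upper M isMax , λ _ _ → z≤n
maxShuffle-tn (suc k) M isMax =
  MaxShuffle.terminatesIn-upper M isMax , LowerBound.terminatesIn-lower M isMax

theorem6 : (n : ℕ) (M M′ : Permutation′ (suc n) → Permutation′ (suc n)) →
    IsMaxShuffle M → IsMaxShuffle M′ →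
    Σ ℕ (λ t → IsTerminationNumber M t × IsTerminationNumber M′ t)
theorem6 n M M′ isMax isMax′ = n + n ∸ 1 , maxShuffle-tn n M isMax , maxShuffle-tn n M′ isMax′
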